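{- Let $A_5$ be the set of integers $n$ with $0<n\le 99999$ whose five-digit decimal representation (padding with leading zeros) does not have all five digits equal, and let $K:A_5\to A_5$ be the Kaprekar map: $K(n)=X-Y$, where $X$ is the five-digit number obtained by arranging the digits of $n$ in descending order and $Y$ is obtained by arranging them in ascending order. Let $B_5=\{K(n):n\in A_5\}$. Then a number $n$ with five-digit representation $(a\,b\,c\,d\,e)$ belongs to $B_5$ if and only if one of the following holds: (1) $n=(a\,b\,9\,(8-b)\,(10-a))$ with integers $b\ge 0$ and $b+1\le a\le 9$; (2) $n=(a\,9\,9\,9\,(9-a))$ with an integer $0\le a\le 8$.
   Context: Here $(a\,b\,c\,d\,e)$ denotes the number $a\cdot 10^4+b\cdot 10^3+c\cdot 10^2+d\cdot 10+e$ with digits in $\{0,\dots,9\}$. -}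

module Defs where

open import Data.Nat using (ℕ; _+_; _*_; _∸_; _^_; _≤_; _<_)
open import Data.Nat.DivMod using (_/_; _%_)
open import Data.Nat.Properties using (≤-decTotalOrder)
open import Data.List using (List; []; _∷_; foldl; reverse)
open import Data.List.Relation.Unary.All using (All)
open import Data.Product using (_×_; ∃-syntax)
open import Relation.Binary.PropositionalEquality using (_≡_)
open import Relation.Nullary using (¬_)
import Data.List.Sort.InsertionSort.Base as ISort

sortAsc : List ℕ → List ℕ
sortAsc = ISort.sort ≤-decTotalOrder

digits5 : ℕ → List ℕ
digits5 n = (n / 10000) % 10 ∷ (n / 1000) % 10 ∷ (n / 100) % 10 ∷ (n / 10) % 10 ∷ n % 10 ∷ []

fromDigits : List ℕ → ℕ
fromDigits = foldl (λ acc d → 10 * acc + d) 0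

num5 : ℕ → ℕ → ℕ → ℕ → ℕ → ℕ
num5 a b c d e = a * 10 ^ 4 + b * 10 ^ 3 + c * 10 ^ 2 + d * 10 + e

A5 : ℕ → Set
A5 n = 0 < n × n ≤ 99999 × ¬ All (λ d → d ≡ n % 10) (digits5 n)

K : ℕ → ℕ
K n = fromDigits (reverse (sortAsc (digits5 n))) ∸ fromDigits (sortAsc (digits5 n))

B5 : ℕ → Set
B5 n = ∃[ m ] (A5 m × K m ≡ n)

{-# OPTIONS --safe #-}
-- If the digits of n sorted increasingly are a ≤ b ≤ c ≤ d ≤ e, then
-- K n = (e d c b a) − (a b c d e) = 9999 (e − a) + 990 (d − b).
-- Hence B5 consists exactly of the numbers 9999 p + 990 q with 1 ≤ p ≤ 9 and q ≤ p
-- (p ≠ 0 because the digits are not all equal), each attained by the number with digits 0 0 0 q p.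
-- Written in decimal, 9999 p + 990 q is pattern (2) with a = p − 1 when q = 0,
-- and pattern (1) with a = p, b = q − 1 otherwise.
module Submission where

open import Defs
open import Data.Nat using (ℕ; zero; suc; _+_; _*_; _∸_; _≤_; _<_; _^_; _%_; _/_; z≤n; s≤s; NonZero)
open import Data.Nat.Properties
  using (≤-decTotalOrder; ≤-refl; n≮0; ≤-totalOrder; ≤-trans; <⇒≤; <-≤-trans; ≤-pred; m≤m+n; m≤n+m; +-mono-≤; *-monoˡ-≤;
         +-comm; +-identityʳ; n≤1+n; +-cancelˡ-≡; +-cancelʳ-≡; m+n∸m≡n; m∸n+n≡m; m≤n⇒∃[o]m+o≡n)
open import Data.Nat.DivMod using (m%n<n; m<n⇒m/n≡0; m<n⇒m%n≡m; m*n/n≡m; [m+kn]%n≡m%n; +-distrib-/-∣ʳ)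
open import Data.Nat.Divisibility using (n∣m*n)
open import Data.Nat.Tactic.RingSolver using (solve-∀)
open import Data.Product using (_×_; ∃-syntax; _,_)
open import Data.Sum using (_⊎_; inj₁; inj₂)
open import Data.List using (List; []; _∷_; length; reverse)
open import Data.List.Relation.Unary.All using (All; []; _∷_)
open import Data.List.Relation.Unary.Linked using ([-]; _∷_)
open import Data.List.Relation.Binary.Pointwise using (Pointwise-≡⇒≡)
open import Data.List.Relation.Binary.Permutation.Propositional using (_↭_; ↭-sym; ↭⇒↭ₛ)
open import Data.List.Relation.Binary.Permutation.Propositional.Properties using (↭-length; All-resp-↭)
open import Relation.Binary.PropositionalEquality using (_≡_; refl; sym; trans; cong; cong₂; subst; module ≡-Reasoning)
open import Relation.Nullary using (¬_)
open import Function.Bundles using (_⇔_; mk⇔)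
open import Function.Construct.Composition using (_⇔-∘_)
open import Data.List.Relation.Unary.Sorted.TotalOrder ≤-totalOrder using (Sorted)
import Data.List.Relation.Unary.Sorted.TotalOrder.Properties as Sorted
import Data.List.Sort.InsertionSort.Properties ≤-decTotalOrder as InsertionSort

open ≡-Reasoning

Constant : List ℕ → Set
Constant xs = ∃[ c ] All (_≡ c) xs

sortAsc-↭ : ∀ xs → sortAsc xs ↭ xs
sortAsc-↭ = InsertionSort.sort-↭

sortAsc-↗ : ∀ xs → Sorted (sortAsc xs)
sortAsc-↗ = InsertionSort.sort-↗

sortAsc-sorted : ∀ {xs} → Sorted xs → sortAsc xs ≡ xs
sortAsc-sorted {xs} xs↗ =
  Pointwise-≡⇒≡ (Sorted.↗↭↗⇒≋ ≤-totalOrder (sortAsc-↗ xs) xs↗ (↭⇒↭ₛ (sortAsc-↭ xs)))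

ascending : ℕ → ℕ → ℕ → ℕ → ℕ → List ℕ
ascending x i j k l = x ∷ x + i ∷ x + i + j ∷ x + i + j + k ∷ x + i + j + k + l ∷ []

ascending-↗ : ∀ x i j k l → Sorted (ascending x i j k l)
ascending-↗ x i j k l =
  m≤m+n x i ∷ m≤m+n (x + i) j ∷ m≤m+n (x + i + j) k ∷ m≤m+n (x + i + j + k) l ∷ [-]

ascending-last : ∀ x i j k l → x + i + j + k + l ≡ x + (i + j + k + l)
ascending-last = solve-∀

ascending-nonconstant : ∀ x i j k l → 1 ≤ i + j + k + l → ¬ Constant (ascending x i j k l)
ascending-nonconstant x i j k l 1≤p (c , x≡c ∷ _ ∷ _ ∷ _ ∷ last≡c ∷ []) =
  n≮0 (subst (1 ≤_) p≡0 1≤p)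
  where
  p≡0 : i + j + k + l ≡ 0
  p≡0 = +-cancelˡ-≡ x _ 0 (begin
    x + (i + j + k + l) ≡⟨ sym (ascending-last x i j k l) ⟩
    x + i + j + k + l   ≡⟨ trans last≡c (sym x≡c) ⟩
    x                   ≡⟨ sym (+-identityʳ x) ⟩
    x + 0               ∎)

ascending-flat : ∀ x → All (_≡ x) (ascending x 0 0 0 0)
ascending-flat x = refl ∷ x+0 ∷ x+0+0 ∷ x+0+0+0 ∷ trans (cong (_+ 0) x+0+0+0) x+0 ∷ []
  where
  x+0 : x + 0 ≡ x
  x+0 = +-identityʳ x
  x+0+0 : x + 0 + 0 ≡ x
  x+0+0 = trans (cong (_+ 0) x+0) x+0
  x+0+0+0 : x + 0 + 0 + 0 ≡ x
  x+0+0+0 = trans (cong (_+ 0) x+0+0) x+0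

ascending-spread : ∀ x i j k l → ¬ Constant (ascending x i j k l) → 1 ≤ i + j + k + l
ascending-spread x zero    zero    zero    zero    nc with () ← nc (x , ascending-flat x)
ascending-spread x (suc i) j       k       l       _  = s≤s z≤n
ascending-spread x zero    (suc j) k       l       _  = s≤s z≤n
ascending-spread x zero    zero    (suc k) l       _  = s≤s z≤n
ascending-spread x zero    zero    zero    (suc l) _  = s≤s z≤n

kaprekarDifference : List ℕ → ℕ
kaprekarDifference s = fromDigits (reverse s) ∸ fromDigits s

kaprekarDifference-ascending : ∀ x i j k l →
  kaprekarDifference (ascending x i j k l) ≡ 9999 * (i + j + k + l) + 990 * (j + k)
kaprekarDifference-ascending x i j k l = begin
  fromDigits (reverse s) ∸ fromDigits s
    ≡⟨ cong (_∸ fromDigits s) (reverse-expanded x i j k l) ⟩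
  fromDigits s + (9999 * (i + j + k + l) + 990 * (j + k)) ∸ fromDigits s
    ≡⟨ m+n∸m≡n (fromDigits s) _ ⟩
  9999 * (i + j + k + l) + 990 * (j + k) ∎
  where
  s : List ℕ
  s = ascending x i j k l
  reverse-expanded : ∀ x i j k l →
    10 * (10 * (10 * (10 * (10 * 0 + (x + i + j + k + l)) + (x + i + j + k)) + (x + i + j)) + (x + i)) + x
    ≡ 10 * (10 * (10 * (10 * (10 * 0 + x) + (x + i)) + (x + i + j)) + (x + i + j + k)) + (x + i + j + k + l)
      + (9999 * (i + j + k + l) + 990 * (j + k))
  reverse-expanded = solve-∀

KaprekarValue : ℕ → Set
KaprekarValue n = ∃[ p ] ∃[ q ] (1 ≤ p × p ≤ 9 × q ≤ p × n ≡ 9999 * p + 990 * q)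

kaprekarValue-sorted : ∀ {s} → Sorted s → length s ≡ 5 → All (_< 10) s → ¬ Constant s →
  KaprekarValue (kaprekarDifference s)
kaprekarValue-sorted {x ∷ _ ∷ _ ∷ _ ∷ _ ∷ []} (x≤y ∷ y≤z ∷ z≤w ∷ w≤v ∷ [-]) refl (_ ∷ _ ∷ _ ∷ _ ∷ v<10 ∷ []) nc
  with m≤n⇒∃[o]m+o≡n x≤y | m≤n⇒∃[o]m+o≡n y≤z | m≤n⇒∃[o]m+o≡n z≤w | m≤n⇒∃[o]m+o≡n w≤v
... | i , refl | j , refl | k , refl | l , refl =
  i + j + k + l , j + k , ascending-spread x i j k l nc , spread≤9 , inner≤spread ,
  kaprekarDifference-ascending x i j k l
  where
  spread≤9 : i + j + k + l ≤ 9
  spread≤9 = ≤-pred (≤-trans (s≤s (m≤n+m _ x)) (subst (_< 10) (ascending-last x i j k l) v<10))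
  inner+outer : ∀ i j k l → j + k + (i + l) ≡ i + j + k + l
  inner+outer = solve-∀
  inner≤spread : j + k ≤ i + j + k + l
  inner≤spread = subst (j + k ≤_) (inner+outer i j k l) (m≤m+n (j + k) (i + l))

digits5-< : ∀ n → All (_< 10) (digits5 n)
digits5-< n =
  m%n<n (n / 10000) 10 ∷ m%n<n (n / 1000) 10 ∷ m%n<n (n / 100) 10 ∷ m%n<n (n / 10) 10 ∷ m%n<n n 10 ∷ []

digits5-nonconstant : ∀ n → ¬ All (_≡ n % 10) (digits5 n) → ¬ Constant (digits5 n)
digits5-nonconstant n notAll (c , e₁ ∷ e₂ ∷ e₃ ∷ e₄ ∷ e₅ ∷ []) =
  notAll (trans e₁ (sym e₅) ∷ trans e₂ (sym e₅) ∷ trans e₃ (sym e₅) ∷ trans e₄ (sym e₅) ∷ refl ∷ [])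

B5⇒KaprekarValue : ∀ {n} → B5 n → KaprekarValue n
B5⇒KaprekarValue (m , (_ , _ , notAll) , refl) =
  kaprekarValue-sorted (sortAsc-↗ (digits5 m)) (↭-length perm) (All-resp-↭ (↭-sym perm) (digits5-< m))
    nonconstant
  where
  perm : sortAsc (digits5 m) ↭ digits5 m
  perm = sortAsc-↭ (digits5 m)
  nonconstant : ¬ Constant (sortAsc (digits5 m))
  nonconstant (c , all) = digits5-nonconstant m notAll (c , All-resp-↭ perm all)

twoDigit<100 : ∀ {q r} → q < 10 → r < 10 → r + q * 10 < 100
twoDigit<100 q<10 r<10 = +-mono-≤ r<10 (*-monoˡ-≤ 10 (≤-pred q<10))

digits5-twoDigit : ∀ {q r} → q < 10 → r < 10 → digits5 (r + q * 10) ≡ 0 ∷ 0 ∷ 0 ∷ q ∷ r ∷ []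
digits5-twoDigit {q} {r} q<10 r<10 =
  cong₂ _∷_ (leading 10000 (m≤m+n 100 9900)) (cong₂ _∷_ (leading 1000 (m≤m+n 100 900))
    (cong₂ _∷_ (leading 100 ≤-refl) (cong₂ _∷_ tens (cong (_∷ []) units))))
  where
  m<100 : r + q * 10 < 100
  m<100 = twoDigit<100 q<10 r<10
  m/10≡q : (r + q * 10) / 10 ≡ q
  m/10≡q = begin
    (r + q * 10) / 10     ≡⟨ +-distrib-/-∣ʳ r (n∣m*n q) ⟩
    r / 10 + q * 10 / 10  ≡⟨ cong₂ _+_ (m<n⇒m/n≡0 r<10) (m*n/n≡m q 10) ⟩
    q                     ∎
  leading : ∀ d .{{_ : NonZero d}} → 100 ≤ d → (r + q * 10) / d % 10 ≡ 0
  leading d 100≤d = cong (_% 10) (m<n⇒m/n≡0 (<-≤-trans m<100 100≤d))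
  tens : (r + q * 10) / 10 % 10 ≡ q
  tens = trans (cong (_% 10) m/10≡q) (m<n⇒m%n≡m q<10)
  units : (r + q * 10) % 10 ≡ r
  units = trans ([m+kn]%n≡m%n r q 10) (m<n⇒m%n≡m r<10)

KaprekarValue⇒B5 : ∀ {n} → KaprekarValue n → B5 n
KaprekarValue⇒B5 (_ , q , 1≤p , p≤9 , q≤p , refl) with m≤n⇒∃[o]m+o≡n q≤p
... | r , refl = m , (0<m , m≤99999 , notAll) , K-m
  where
  m : ℕ
  m = q + r + q * 10
  q<10 : q < 10
  q<10 = s≤s (≤-trans (m≤m+n q r) p≤9)
  digits : digits5 m ≡ ascending 0 0 0 q r
  digits = digits5-twoDigit q<10 (s≤s p≤9)
  0<m : 0 < m
  0<m = ≤-trans 1≤p (m≤m+n (q + r) (q * 10))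
  m≤99999 : m ≤ 99999
  m≤99999 = ≤-trans (<⇒≤ (twoDigit<100 q<10 (s≤s p≤9))) (m≤m+n 100 99899)
  notAll : ¬ All (_≡ m % 10) (digits5 m)
  notAll all = ascending-nonconstant 0 0 0 q r 1≤p (m % 10 , subst (All (_≡ m % 10)) digits all)
  K-m : K m ≡ 9999 * (q + r) + 990 * q
  K-m = begin
    kaprekarDifference (sortAsc (digits5 m))            ≡⟨ cong (λ ds → kaprekarDifference (sortAsc ds)) digits ⟩
    kaprekarDifference (sortAsc (ascending 0 0 0 q r))  ≡⟨ cong kaprekarDifference (sortAsc-sorted (ascending-↗ 0 0 0 q r)) ⟩
    kaprekarDifference (ascending 0 0 0 q r)            ≡⟨ kaprekarDifference-ascending 0 0 0 q r ⟩
    9999 * (q + r) + 990 * q                            ∎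

-- Adding 10 * b + a to both sides turns the truncated differences 8 ∸ b and 10 ∸ a into constants.
num5-pattern₁ : ∀ {a b} → b + 1 ≤ a → a ≤ 9 → num5 a b 9 (8 ∸ b) (10 ∸ a) ≡ 9999 * a + 990 * suc b
num5-pattern₁ {a} {b} b+1≤a a≤9 = +-cancelʳ-≡ (10 * b + a) _ _ (begin
  num5 a b 9 (8 ∸ b) (10 ∸ a) + (10 * b + a)
    ≡⟨ regroup a b (8 ∸ b) (10 ∸ a) ⟩
  a * 10000 + b * 1000 + 900 + 10 * (8 ∸ b + b) + (10 ∸ a + a)
    ≡⟨ cong₂ (λ u v → a * 10000 + b * 1000 + 900 + 10 * u + v) (m∸n+n≡m b≤8) (m∸n+n≡m a≤10) ⟩
  a * 10000 + b * 1000 + 900 + 10 * 8 + 10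
    ≡⟨ collect a b ⟩
  9999 * a + 990 * suc b + (10 * b + a) ∎)
  where
  b≤8 : b ≤ 8
  b≤8 = ≤-pred (≤-trans (subst (_≤ a) (+-comm b 1) b+1≤a) a≤9)
  a≤10 : a ≤ 10
  a≤10 = ≤-trans a≤9 (n≤1+n 9)
  regroup : ∀ a b u v → a * 10 ^ 4 + b * 10 ^ 3 + 9 * 10 ^ 2 + u * 10 + v + (10 * b + a)
                        ≡ a * 10000 + b * 1000 + 900 + 10 * (u + b) + (v + a)
  regroup = solve-∀
  collect : ∀ a b → a * 10000 + b * 1000 + 900 + 10 * 8 + 10 ≡ 9999 * a + 990 * (1 + b) + (10 * b + a)
  collect = solve-∀

num5-pattern₂ : ∀ {a} → a ≤ 8 → num5 a 9 9 9 (9 ∸ a) ≡ 9999 * suc a + 990 * 0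
num5-pattern₂ {a} a≤8 = +-cancelʳ-≡ a _ _ (begin
  num5 a 9 9 9 (9 ∸ a) + a       ≡⟨ regroup a (9 ∸ a) ⟩
  a * 10000 + 9990 + (9 ∸ a + a) ≡⟨ cong (λ v → a * 10000 + 9990 + v) (m∸n+n≡m a≤9) ⟩
  a * 10000 + 9990 + 9           ≡⟨ collect a ⟩
  9999 * suc a + 990 * 0 + a     ∎)
  where
  a≤9 : a ≤ 9
  a≤9 = ≤-trans a≤8 (n≤1+n 8)
  regroup : ∀ a v → a * 10 ^ 4 + 9 * 10 ^ 3 + 9 * 10 ^ 2 + 9 * 10 + v + a ≡ a * 10000 + 9990 + (v + a)
  regroup = solve-∀
  collect : ∀ a → a * 10000 + 9990 + 9 ≡ 9999 * (1 + a) + 990 * 0 + a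
  collect = solve-∀

B5Pattern : ℕ → Set
B5Pattern n = (∃[ a ] ∃[ b ] (b + 1 ≤ a × a ≤ 9 × n ≡ num5 a b 9 (8 ∸ b) (10 ∸ a)))
            ⊎ (∃[ a ] (a ≤ 8 × n ≡ num5 a 9 9 9 (9 ∸ a)))

KaprekarValue⇔B5Pattern : ∀ {n} → KaprekarValue n ⇔ B5Pattern n
KaprekarValue⇔B5Pattern = mk⇔ to from
  where
  to : ∀ {n} → KaprekarValue n → B5Pattern n
  to (suc a , zero  , _ , p≤9 , _   , refl) = inj₂ (a , ≤-pred p≤9 , sym (num5-pattern₂ (≤-pred p≤9)))
  to (p     , suc b , _ , p≤9 , q≤p , refl) = inj₁ (p , b , b+1≤p , p≤9 , sym (num5-pattern₁ b+1≤p p≤9))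
    where
    b+1≤p : b + 1 ≤ p
    b+1≤p = subst (_≤ p) (+-comm 1 b) q≤p
  from : ∀ {n} → B5Pattern n → KaprekarValue n
  from (inj₁ (a , b , b+1≤a , a≤9 , refl)) =
    a , suc b , ≤-trans (m≤n+m 1 b) b+1≤a , a≤9 , subst (_≤ a) (+-comm b 1) b+1≤a , num5-pattern₁ b+1≤a a≤9
  from (inj₂ (a , a≤8 , refl)) = suc a , 0 , s≤s z≤n , s≤s a≤8 , z≤n , num5-pattern₂ a≤8

mainTheorem2 : (n : ℕ) → n ≤ 99999 →
    (B5 n ⇔
    ((∃[ a ] ∃[ b ] (b + 1 ≤ a × a ≤ 9 × n ≡ num5 a b 9 (8 ∸ b) (10 ∸ a)))
    ⊎ (∃[ a ] (a ≤ 8 × n ≡ num5 a 9 9 9 (9 ∸ a)))))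
mainTheorem2 n _ = KaprekarValue⇔B5Pattern ⇔-∘ mk⇔ B5⇒KaprekarValue KaprekarValue⇒B5
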